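{- Let $P$ be an annotated $\pi$-term such that $\mathrm{forest}(P)$ is $\mathcal T$-compatible. Then there exists a term $Q$ such that $\mathrm{forest}(Q)$ is $\mathcal T$-compatible, $Q$ is an $\alpha$-renaming of $P$, every restriction-bound name of $Q$ lies in $X_{\mathcal T}$, and every active sequential subterm of $Q$ belongs to $\mathrm{Deriv}[P]$.
   Context: $\pi$-terms: $P ::= \nu x.P \mid P_1\parallel P_2 \mid M \mid\, !M$, $M ::= \mathbf 0 \mid M+M \mid \pi.P$, $\pi ::= a(x)\mid \overline a\langle b\rangle \mid \tau$; $\mathrm{fn}$ free names; $M$, $!M$ are sequential; a subterm is active if it is not under a prefix. $(\mathcal T,\lessdot)$ is a finite forest of base types, $<$ transitive closure of the parent relation. Types $\tau::=t\mid t[\tau]$, $\mathrm{base}(t)=\mathrm{base}(t[\tau])=t$; annotated terms have restrictions $\nu(x{:}\tau)$ and $\alpha$-renaming keeps annotations. $\mathrm{forest}(\nu(x{:}\tau).Q)$ is a root labelled $(x,\mathrm{base}(\tau))$ with the roots of $\mathrm{forest}(Q)$ as children; $\mathrm{forest}(Q_1\parallel Q_2)$ disjoint union; sequential $Q$ gives a single node labelled $Q$; $\mathrm{forest}(\mathbf 0)$ empty. A forest is $\mathcal T$-compatible if along every path $n_1\cdots n_kn$ (parent to child) with $n$ labelled by a sequential term and $n_i$ labelled $(x_i,t_i)$, $t_1<\cdots<t_k$. $X_{\mathcal T}=\{\chi_t\mid t\in\mathcal T\}$ is a finite set of names (one per base type). Derivatives: $\mathrm{der}(\mathbf 0)=\emptyset$,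 $\mathrm{der}(\nu x.P)=\mathrm{der}(P)$, $\mathrm{der}(P\parallel Q)=\mathrm{der}(P)\cup\mathrm{der}(Q)$, $\mathrm{der}(!M)=\{!M\}\cup\mathrm{der}(M)$, $\mathrm{der}(M+M')=\{M+M'\}\cup\mathrm{der}(M)\cup\mathrm{der}(M')$, $\mathrm{der}(\pi.P)=\{\pi.P\}\cup\mathrm{der}(P)$. $\mathrm{Deriv}[P]=\{Q\sigma\mid Q\in\mathrm{der}(P),\ \sigma:\mathrm{fn}(Q)\to X_{\mathcal T}\cup\mathrm{fn}(P)\}$, $Q\sigma$ denoting substitution of free names. -}

module Defs where

open import Data.Nat using (ℕ; _≟_)
open import Data.Fin using (Fin)
open import Data.Maybe using (Maybe; just)
open import Data.List using (List; []; _∷_; _++_; _∷ʳ_; filter)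
open import Data.List.Membership.Propositional using (_∈_; _∉_)
open import Data.List.Relation.Unary.Linked using (Linked)
open import Data.Product using (_×_; _,_; Σ; ∃)
open import Data.Sum using (_⊎_)
open import Data.Unit using (⊤)
open import Relation.Nullary using (¬_; ¬?)
open import Relation.Binary.PropositionalEquality using (_≡_; _≢_)
open import Relation.Binary.Construct.Closure.Transitive using (TransClosure)

-- Names: an infinite supply, modelled by ℕ.

Name : Set
Name = ℕ

record TypeForest : Set where
  field
    size   : ℕ
    parent : Fin size → Maybe (Fin size)

  _⋖_ : Fin size → Fin size → Set
  t ⋖ u = parent u ≡ just t

  _<ᵀ_ : Fin size → Fin size → Set
  _<ᵀ_ = TransClosure _⋖_

  field
    acyclic : ∀ t → ¬ (t <ᵀ t)

open TypeForest public

data Ty (k : ℕ) : Set where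
  bt  : Fin k → Ty k
  _[_] : Fin k → Ty k → Ty k

base : ∀ {k} → Ty k → Fin k
base (bt t)    = t
base (t [ _ ]) = t

data Prefix : Set where
  inp : Name → Name → Prefix      -- a(x)   (x bound)
  out : Name → Name → Prefix
  tau : Prefix

mutual
  data Proc (k : ℕ) : Set where
    ν    : Name → Ty k → Proc k → Proc k
    _∥_  : Proc k → Proc k → Proc k
    sq   : Sum k → Proc k
    bang : Sum k → Proc k

  data Sum (k : ℕ) : Set where
    nil : Sum k
    _⊕_ : Sum k → Sum k → Sum k
    pre : Prefix → Proc k → Sum k

𝟘 : ∀ {k} → Proc k
𝟘 = sq nil

remove : Name → List Name → List Name
remove x = filter (λ y → ¬? (y ≟ x))

mutual
  fn : ∀ {k} → Proc k → List Name
  fn (ν x _ P) = remove x (fn P)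
  fn (P ∥ Q)   = fn P ++ fn Q
  fn (sq M)    = fnS M
  fn (bang M)  = fnS M

  fnS : ∀ {k} → Sum k → List Name
  fnS nil                 = []
  fnS (M ⊕ M')            = fnS M ++ fnS M'
  fnS (pre (inp a x) P)   = a ∷ remove x (fn P)
  fnS (pre (out a b) P)   = a ∷ b ∷ fn P
  fnS (pre tau P)         = fn P

data Node (k : ℕ) : Set where
  resN : Name → Fin k → List (Node k) → Node k
  seqN : Proc k → Node k

forest : ∀ {k} → Proc k → List (Node k)
forest (ν x τ P)       = resN x (base τ) (forest P) ∷ []
forest (P ∥ Q)         = forest P ++ forest Q
forest (sq nil)        = []
forest (sq (M ⊕ M'))   = seqN (sq (M ⊕ M')) ∷ []
forest (sq (pre π P))  = seqN (sq (pre π P)) ∷ []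
forest (bang M)        = seqN (bang M) ∷ []

-- 𝒯-compatibility: along every root-to-node path n₁ ⋯ nₖ n with n labelled
-- by a sequential term and nᵢ labelled (xᵢ, tᵢ), we have t₁ < ⋯ < tₖ.
-- The list argument records the types t₁ ⋯ tᵢ on the path so far.
module _ (𝒯 : TypeForest) where
  mutual
    CompatNode : List (Fin (size 𝒯)) → Node (size 𝒯) → Set
    CompatNode ts (resN x t cs) = CompatNodes (ts ∷ʳ t) cs
    CompatNode ts (seqN _)      = Linked (_<ᵀ_ 𝒯) ts

    CompatNodes : List (Fin (size 𝒯)) → List (Node (size 𝒯)) → Set
    CompatNodes ts []       = ⊤
    CompatNodes ts (n ∷ ns) = CompatNode ts n × CompatNodes ts ns

  Compatible : List (Node (size 𝒯)) → Set
  Compatible F = CompatNodes [] F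

mutual
  der : ∀ {k} → Proc k → List (Proc k)
  der (ν _ _ P) = der P
  der (P ∥ Q)   = der P ++ der Q
  der (sq M)    = derS M
  der (bang M)  = bang M ∷ derS M

  derS : ∀ {k} → Sum k → List (Proc k)
  derS nil        = []
  derS (M ⊕ M')   = sq (M ⊕ M') ∷ (derS M ++ derS M')
  derS (pre π P)  = sq (pre π P) ∷ der P

-- InstP σ Γ R S : S is α-equivalent to R with its free names substituted
-- by σ.  Γ lists the pairs of corresponding bound names (innermost first).

Env : Set
Env = List (Name × Name)

data NameRel (σ : Name → Name) : Env → Name → Name → Set where
  free  : ∀ {x} → NameRel σ [] x (σ x)
  here  : ∀ {Γ x y} → NameRel σ ((x , y) ∷ Γ) x y
  there : ∀ {Γ x y x' y'} → x ≢ x' → y ≢ y' →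
          NameRel σ Γ x y → NameRel σ ((x' , y') ∷ Γ) x y

mutual
  data InstP {k} (σ : Name → Name) : Env → Proc k → Proc k → Set where
    ν    : ∀ {Γ x y τ P Q} → InstP σ ((x , y) ∷ Γ) P Q →
           InstP σ Γ (ν x τ P) (ν y τ Q)
    par  : ∀ {Γ P P' Q Q'} → InstP σ Γ P Q → InstP σ Γ P' Q' →
           InstP σ Γ (P ∥ P') (Q ∥ Q')
    sq   : ∀ {Γ M N} → InstS σ Γ M N → InstP σ Γ (sq M) (sq N)
    bang : ∀ {Γ M N} → InstS σ Γ M N → InstP σ Γ (bang M) (bang N)

  data InstS {k} (σ : Name → Name) : Env → Sum k → Sum k → Set where
    nil : ∀ {Γ} → InstS σ Γ nil nil
    sum : ∀ {Γ M M' N N'} → InstS σ Γ M N → InstS σ Γ M' N' →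
          InstS σ Γ (M ⊕ M') (N ⊕ N')
    inp : ∀ {Γ a b x y P Q} → NameRel σ Γ a b →
          InstP σ ((x , y) ∷ Γ) P Q →
          InstS σ Γ (pre (inp a x) P) (pre (inp b y) Q)
    out : ∀ {Γ a b c d P Q} → NameRel σ Γ a b → NameRel σ Γ c d →
          InstP σ Γ P Q →
          InstS σ Γ (pre (out a c) P) (pre (out b d) Q)
    tau : ∀ {Γ P Q} → InstP σ Γ P Q →
          InstS σ Γ (pre tau P) (pre tau Q)

AlphaRenaming : ∀ {k} → Proc k → Proc k → Set
AlphaRenaming P Q = InstP (λ x → x) [] P Q

_∈X_ : ∀ {k} → Name → (Fin k → Name) → Set
x ∈X χ = ∃ λ t → χ t ≡ x

-- Deriv[P] (membership taken up to α-conversion, substitution capture-avoiding)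
_∈Deriv[_]_ : ∀ {k} → Proc k → Proc k → (Fin k → Name) → Set
S ∈Deriv[ P ] χ =
  Σ _ λ R → R ∈ der P × Σ (Name → Name) λ σ →
    (∀ x → x ∈ fn R → (σ x ∈X χ) ⊎ (σ x ∈ fn P)) × InstP σ [] R S

-- Restriction-bound names (active restrictions, i.e. the ν-nodes of the
-- forest) and active sequential subterms (the sequential nodes of the forest)

resNames : ∀ {k} → Proc k → List Name
resNames (ν x _ P) = x ∷ resNames P
resNames (P ∥ Q)   = resNames P ++ resNames Q
resNames (sq _)    = []
resNames (bang _)  = []

activeSeq : ∀ {k} → Proc k → List (Proc k)
activeSeq (ν _ _ P)       = activeSeq P
activeSeq (P ∥ Q)         = activeSeq P ++ activeSeq Q
activeSeq (sq nil)        = []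
activeSeq (sq (M ⊕ M'))   = sq (M ⊕ M') ∷ []
activeSeq (sq (pre π P))  = sq (pre π P) ∷ []
activeSeq (bang M)        = bang M ∷ []

-- Rename every active restriction ν(x:τ) to χ (base τ) and every other
-- bound name to a fresh name.  Compatibility makes the base types along any
-- root-to-leaf path of the forest strictly increasing in the acyclic order
-- <ᵀ, hence pairwise distinct, so by injectivity of χ the new names of
-- nested restrictions never shadow each other; since no χ t is free in P,
-- they cannot capture a free name either.  The renaming is therefore an
-- α-renaming, and each active sequential subterm of the result is a
-- derivative of P whose free names were substituted by names in X_𝒯 ∪ fn P.
module Submission where

open import Defs
open import Data.Empty using (⊥-elim)
open import Data.Fin using (Fin)
open import Data.List using (List; []; _∷_; _++_; _∷ʳ_; map)
open import Data.List.Extrema.Nat using (max; xs≤max)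
open import Data.List.Membership.Propositional using (_∈_; _∉_)
open import Data.List.Membership.Propositional.Properties
  using (∈-map⁺; ∈-++⁺ˡ; ∈-++⁺ʳ; ∈-++⁻; ∈-filter⁺)
open import Data.List.Relation.Binary.Subset.Propositional using (_⊆_)
open import Data.List.Relation.Unary.All as All using (All; []; _∷_)
open import Data.List.Relation.Unary.Any using (here; there)
open import Data.List.Relation.Unary.Linked using (Linked; []; [-]; _∷_)
open import Data.Nat using (suc; _≟_)
open import Data.Nat.Properties using (n≮n)
open import Data.Product using (_×_; Σ; _,_; proj₁; proj₂; ∃)
open import Data.Sum using (_⊎_; inj₁; inj₂)
open import Data.Unit using (⊤; tt)
open import Function using (_∘_; id)
open import Function.Definitions using (Injective)
open import Relation.Binary.Definitions using (Transitive)
open import Relation.Binary.Construct.Closure.Transitive using (transitive)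
open import Relation.Binary.PropositionalEquality using (_≡_; refl; sym; trans; subst; _≢_)
open import Relation.Nullary using (¬?; yes; no)

fresh : List Name → Name
fresh xs = suc (max 0 xs)

fresh-∉ : ∀ xs → fresh xs ∉ xs
fresh-∉ xs p = n≮n (max 0 xs) (All.lookup (xs≤max 0 xs) p)

∈-remove⁺ : ∀ {a x xs} → a ∈ xs → a ≢ x → a ∈ remove x xs
∈-remove⁺ {x = x} = ∈-filter⁺ (λ y → ¬? (y ≟ x))

Linked-∷ʳ⁻ : ∀ {A : Set} {R : A → A → Set} → Transitive R →
             ∀ xs {y} → Linked R (xs ∷ʳ y) → Linked R xs × All (λ x → R x y) xs
Linked-∷ʳ⁻ R-trans []            l       = [] , []
Linked-∷ʳ⁻ R-trans (x ∷ [])      (r ∷ _) = [-] , r ∷ []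
Linked-∷ʳ⁻ R-trans (x ∷ x′ ∷ xs) (r ∷ l) with Linked-∷ʳ⁻ R-trans (x′ ∷ xs) l
... | l′ , rs@(r′ ∷ _) = r ∷ l′ , R-trans r r′ ∷ rs

module _ (𝒯 : TypeForest) where

  CompatNodes-++⁻ : ∀ ts xs {ys} → CompatNodes 𝒯 ts (xs ++ ys) →
                    CompatNodes 𝒯 ts xs × CompatNodes 𝒯 ts ys
  CompatNodes-++⁻ ts []       c       = tt , c
  CompatNodes-++⁻ ts (x ∷ xs) (a , c) with CompatNodes-++⁻ ts xs c
  ... | p , q = (a , p) , q

  CompatNodes-++⁺ : ∀ ts xs {ys} → CompatNodes 𝒯 ts xs → CompatNodes 𝒯 ts ys →
                    CompatNodes 𝒯 ts (xs ++ ys)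
  CompatNodes-++⁺ ts []       _       q = q
  CompatNodes-++⁺ ts (x ∷ xs) (a , p) q = a , CompatNodes-++⁺ ts xs p q

dom targets : Env → List Name
dom     = map proj₁
targets = map proj₂

lookupEnv : Env → Name → Name
lookupEnv []            a = a
lookupEnv ((x , y) ∷ Γ) a with a ≟ x
... | yes _ = y
... | no  _ = lookupEnv Γ a

lookupEnv-cases : ∀ Γ a → lookupEnv Γ a ∈ targets Γ ⊎ (a ∉ dom Γ × lookupEnv Γ a ≡ a)
lookupEnv-cases []            a = inj₂ ((λ ()) , refl)
lookupEnv-cases ((x , y) ∷ Γ) a with a ≟ x
... | yes _ = inj₁ (here refl)
... | no a≢x with lookupEnv-cases Γ a
...   | inj₁ p       = inj₁ (there p)
...   | inj₂ (n , e) = inj₂ ((λ { (here q) → a≢x q ; (there q) → n q }) , e)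

DistinctTargets : Env → Set
DistinctTargets []            = ⊤
DistinctTargets ((x , y) ∷ Γ) = y ∉ targets Γ × DistinctTargets Γ

NameRel-lookupEnv : ∀ {Γ a b} → NameRel (λ z → z) Γ a b → b ≡ lookupEnv Γ a
NameRel-lookupEnv free = refl
NameRel-lookupEnv {_ ∷ _} {a} here with a ≟ a
... | yes _   = refl
... | no  a≢a = ⊥-elim (a≢a refl)
NameRel-lookupEnv {(x , _) ∷ _} {a} (there a≢x _ p) with a ≟ x
... | yes a≡x = ⊥-elim (a≢x a≡x)
... | no  _   = NameRel-lookupEnv p

lookupEnv-NameRel : ∀ Γ a → DistinctTargets Γ → (a ∉ dom Γ → a ∉ targets Γ) →
                    NameRel (λ z → z) Γ a (lookupEnv Γ a)
lookupEnv-NameRel []            a _         _       = free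
lookupEnv-NameRel ((x , y) ∷ Γ) a (y∉Γ , d) unbound with a ≟ x
... | yes refl = here
... | no  a≢x  = there a≢x not-captured (lookupEnv-NameRel Γ a d (λ a∉Γ → unbound′ a∉Γ ∘ there))
  where
    unbound′ : a ∉ dom Γ → a ∉ targets ((x , y) ∷ Γ)
    unbound′ a∉Γ = unbound (λ { (here q) → a≢x q ; (there q) → a∉Γ q })

    not-captured : lookupEnv Γ a ≢ y
    not-captured e with lookupEnv-cases Γ a
    ... | inj₁ p          = y∉Γ (subst (_∈ targets Γ) e p)
    ... | inj₂ (a∉Γ , e′) = unbound′ a∉Γ (here (trans (sym e′) e))

NameRel-env⇒subst : ∀ Δ Γ {a b} → NameRel (λ z → z) (Δ ++ Γ) a b → NameRel (lookupEnv Γ) Δ a b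
NameRel-env⇒subst []      Γ p rewrite NameRel-lookupEnv p = free
NameRel-env⇒subst (_ ∷ Δ) Γ here          = here
NameRel-env⇒subst (_ ∷ Δ) Γ (there n m p) = there n m (NameRel-env⇒subst Δ Γ p)

mutual
  InstP-env⇒subst : ∀ {k} Δ Γ {R S : Proc k} →
                    InstP (λ z → z) (Δ ++ Γ) R S → InstP (lookupEnv Γ) Δ R S
  InstP-env⇒subst Δ Γ (ν p)     = ν (InstP-env⇒subst (_ ∷ Δ) Γ p)
  InstP-env⇒subst Δ Γ (par p q) = par (InstP-env⇒subst Δ Γ p) (InstP-env⇒subst Δ Γ q)
  InstP-env⇒subst Δ Γ (sq p)    = sq (InstS-env⇒subst Δ Γ p)
  InstP-env⇒subst Δ Γ (bang p)  = bang (InstS-env⇒subst Δ Γ p)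

  InstS-env⇒subst : ∀ {k} Δ Γ {R S : Sum k} →
                    InstS (λ z → z) (Δ ++ Γ) R S → InstS (lookupEnv Γ) Δ R S
  InstS-env⇒subst Δ Γ nil         = nil
  InstS-env⇒subst Δ Γ (sum p q)   = sum (InstS-env⇒subst Δ Γ p) (InstS-env⇒subst Δ Γ q)
  InstS-env⇒subst Δ Γ (inp n p)   = inp (NameRel-env⇒subst Δ Γ n) (InstP-env⇒subst (_ ∷ Δ) Γ p)
  InstS-env⇒subst Δ Γ (out n m p) =
    out (NameRel-env⇒subst Δ Γ n) (NameRel-env⇒subst Δ Γ m) (InstP-env⇒subst Δ Γ p)
  InstS-env⇒subst Δ Γ (tau p)     = tau (InstP-env⇒subst Δ Γ p)

freshFor : ∀ {k} → Env → Name → Proc k → Name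
freshFor Γ x P = fresh (map (lookupEnv Γ) (remove x (fn P)))

mutual
  refreshP : ∀ {k} → Env → Proc k → Proc k
  refreshP Γ (ν x τ P) = ν (freshFor Γ x P) τ (refreshP ((x , freshFor Γ x P) ∷ Γ) P)
  refreshP Γ (P ∥ Q)   = refreshP Γ P ∥ refreshP Γ Q
  refreshP Γ (sq M)    = sq (refreshS Γ M)
  refreshP Γ (bang M)  = bang (refreshS Γ M)

  refreshS : ∀ {k} → Env → Sum k → Sum k
  refreshS Γ nil               = nil
  refreshS Γ (M ⊕ M')          = refreshS Γ M ⊕ refreshS Γ M'
  refreshS Γ (pre (inp a x) P) =
    pre (inp (lookupEnv Γ a) (freshFor Γ x P)) (refreshP ((x , freshFor Γ x P) ∷ Γ) P)
  refreshS Γ (pre (out a c) P) = pre (out (lookupEnv Γ a) (lookupEnv Γ c)) (refreshP Γ P)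
  refreshS Γ (pre tau P)       = pre tau (refreshP Γ P)

Resolves : Env → List Name → Set
Resolves Γ ns = ∀ {a} → a ∈ ns → NameRel (λ z → z) Γ a (lookupEnv Γ a)

Resolves-bind : ∀ {k} Γ x (P : Proc k) → Resolves Γ (remove x (fn P)) →
                Resolves ((x , freshFor Γ x P) ∷ Γ) (fn P)
Resolves-bind Γ x P res {a} a∈P with a ≟ x
... | yes refl = here
... | no  a≢x  = there a≢x not-fresh (res a∈P′)
  where
    a∈P′ : a ∈ remove x (fn P)
    a∈P′ = ∈-remove⁺ a∈P a≢x

    not-fresh : lookupEnv Γ a ≢ freshFor Γ x P
    not-fresh e = fresh-∉ _ (subst (_∈ _) e (∈-map⁺ (lookupEnv Γ) a∈P′))

mutual
  refreshP-inst : ∀ {k} Γ (P : Proc k) → Resolves Γ (fn P) → InstP (λ z → z) Γ P (refreshP Γ P)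
  refreshP-inst Γ (ν x τ P) res = ν (refreshP-inst _ P (Resolves-bind Γ x P res))
  refreshP-inst Γ (P ∥ Q)   res =
    par (refreshP-inst Γ P (res ∘ ∈-++⁺ˡ)) (refreshP-inst Γ Q (res ∘ ∈-++⁺ʳ (fn P)))
  refreshP-inst Γ (sq M)    res = sq (refreshS-inst Γ M res)
  refreshP-inst Γ (bang M)  res = bang (refreshS-inst Γ M res)

  refreshS-inst : ∀ {k} Γ (M : Sum k) → Resolves Γ (fnS M) → InstS (λ z → z) Γ M (refreshS Γ M)
  refreshS-inst Γ nil               res = nil
  refreshS-inst Γ (M ⊕ M')          res =
    sum (refreshS-inst Γ M (res ∘ ∈-++⁺ˡ)) (refreshS-inst Γ M' (res ∘ ∈-++⁺ʳ (fnS M)))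
  refreshS-inst Γ (pre (inp a x) P) res =
    inp (res (here refl)) (refreshP-inst _ P (Resolves-bind Γ x P (res ∘ there)))
  refreshS-inst Γ (pre (out a c) P) res =
    out (res (here refl)) (res (there (here refl))) (refreshP-inst Γ P (λ p → res (there (there p))))
  refreshS-inst Γ (pre tau P)       res = tau (refreshP-inst Γ P res)

module Canonical (𝒯 : TypeForest) (χ : Fin (size 𝒯) → Name) (χ-inj : Injective _≡_ _≡_ χ)
                 (P₀ : Proc (size 𝒯)) (χ∉P₀ : ∀ t → χ t ∉ fn P₀) where

  -- PathEnv Γ ts: Γ binds, innermost first, the restrictions of a forest path
  -- whose base types are ts (outermost first), each to χ of its base type.
  data PathEnv : Env → List (Fin (size 𝒯)) → Set where
    []   : PathEnv [] []
    bind : ∀ {Γ ts} x t → PathEnv Γ ts → PathEnv ((x , χ t) ∷ Γ) (ts ∷ʳ t)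

  PathEnv-targets : ∀ {Γ ts y} → PathEnv Γ ts → y ∈ targets Γ → ∃ λ t → t ∈ ts × χ t ≡ y
  PathEnv-targets (bind {ts = ts} x t pe) (here refl) = t , ∈-++⁺ʳ ts (here refl) , refl
  PathEnv-targets (bind x t pe) (there p) with PathEnv-targets pe p
  ... | t′ , t′∈ts , e = t′ , ∈-++⁺ˡ t′∈ts , e

  PathEnv-targets∈X : ∀ {Γ ts y} → PathEnv Γ ts → y ∈ targets Γ → y ∈X χ
  PathEnv-targets∈X pe p with PathEnv-targets pe p
  ... | t , _ , e = t , e

  PathEnv-distinct : ∀ {Γ ts} → PathEnv Γ ts → Linked (_<ᵀ_ 𝒯) ts → DistinctTargets Γ
  PathEnv-distinct []                       _ = tt
  PathEnv-distinct (bind {ts = ts} x t pe) l with Linked-∷ʳ⁻ (transitive (_⋖_ 𝒯)) ts l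
  ... | l′ , below = χt∉Γ , PathEnv-distinct pe l′
    where
      χt∉Γ : χ t ∉ targets _
      χt∉Γ p with PathEnv-targets pe p
      ... | t′ , t′∈ts , e with χ-inj e
      ...   | refl = acyclic 𝒯 t (All.lookup below t′∈ts)

  WellScoped : Env → List Name → Set
  WellScoped Γ ns = ∀ {a} → a ∈ ns → a ∈ dom Γ ⊎ a ∈ fn P₀

  WellScoped-bind : ∀ Γ x y ns → WellScoped Γ (remove x ns) → WellScoped ((x , y) ∷ Γ) ns
  WellScoped-bind Γ x y ns sc {a} a∈ns with a ≟ x
  ... | yes refl = inj₁ (here refl)
  ... | no  a≢x with sc (∈-remove⁺ a∈ns a≢x)
  ...   | inj₁ q = inj₁ (there q)
  ...   | inj₂ q = inj₂ q

  WellScoped⇒Resolves : ∀ {Γ ts ns} → PathEnv Γ ts → Linked (_<ᵀ_ 𝒯) ts →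
                        WellScoped Γ ns → Resolves Γ ns
  WellScoped⇒Resolves {Γ} pe l sc {a} a∈ns =
    lookupEnv-NameRel Γ a (PathEnv-distinct pe l) unbound
    where
      unbound : a ∉ dom Γ → a ∉ targets Γ
      unbound a∉Γ a∈Γ with sc a∈ns | PathEnv-targets∈X pe a∈Γ
      ... | inj₁ q   | _         = a∉Γ q
      ... | inj₂ a∈P | t , refl = χ∉P₀ t a∈P

  WellScoped-lookupEnv : ∀ {Γ ts ns} → PathEnv Γ ts → WellScoped Γ ns →
                         ∀ a → a ∈ ns → lookupEnv Γ a ∈X χ ⊎ lookupEnv Γ a ∈ fn P₀
  WellScoped-lookupEnv {Γ} pe sc a a∈ns with lookupEnv-cases Γ a
  ... | inj₁ p = inj₁ (PathEnv-targets∈X pe p)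
  ... | inj₂ (a∉Γ , e) with sc a∈ns
  ...   | inj₁ q = ⊥-elim (a∉Γ q)
  ...   | inj₂ q = inj₂ (subst (_∈ fn P₀) (sym e) q)

  canonical : Env → Proc (size 𝒯) → Proc (size 𝒯)
  canonical Γ (ν x τ P) = ν (χ (base τ)) τ (canonical ((x , χ (base τ)) ∷ Γ) P)
  canonical Γ (P ∥ Q)   = canonical Γ P ∥ canonical Γ Q
  canonical Γ (sq M)    = sq (refreshS Γ M)
  canonical Γ (bang M)  = bang (refreshS Γ M)

  canonical-compatible : ∀ Γ ts P → CompatNodes 𝒯 ts (forest P) →
                         CompatNodes 𝒯 ts (forest (canonical Γ P))
  canonical-compatible Γ ts (ν x τ P) (c , _) = canonical-compatible _ _ P c , tt
  canonical-compatible Γ ts (P ∥ Q)   c with CompatNodes-++⁻ 𝒯 ts (forest P) c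
  ... | p , q = CompatNodes-++⁺ 𝒯 ts (forest (canonical Γ P))
                  (canonical-compatible Γ ts P p) (canonical-compatible Γ ts Q q)
  canonical-compatible Γ ts (sq nil)               c = c
  canonical-compatible Γ ts (sq (M ⊕ M'))          c = c
  canonical-compatible Γ ts (sq (pre (inp a b) P)) c = c
  canonical-compatible Γ ts (sq (pre (out a b) P)) c = c
  canonical-compatible Γ ts (sq (pre tau P))       c = c
  canonical-compatible Γ ts (bang M)               c = c

  canonical-α : ∀ {Γ ts} P → PathEnv Γ ts → CompatNodes 𝒯 ts (forest P) →
                WellScoped Γ (fn P) → InstP (λ z → z) Γ P (canonical Γ P)
  canonical-α (ν x τ P) pe (c , _) sc = ν (canonical-α P (bind x (base τ) pe) c (WellScoped-bind _ x (χ (base τ)) (fn P) sc))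
  canonical-α (P ∥ Q)   pe c       sc with CompatNodes-++⁻ 𝒯 _ (forest P) c
  ... | p , q = par (canonical-α P pe p (sc ∘ ∈-++⁺ˡ)) (canonical-α Q pe q (sc ∘ ∈-++⁺ʳ (fn P)))
  canonical-α (sq nil)       pe _       _  = sq nil
  canonical-α (sq (M ⊕ M'))  pe (l , _) sc = refreshP-inst _ (sq (M ⊕ M')) (WellScoped⇒Resolves pe l sc)
  canonical-α (sq (pre π P)) pe (l , _) sc = refreshP-inst _ (sq (pre π P)) (WellScoped⇒Resolves pe l sc)
  canonical-α (bang M)       pe (l , _) sc = refreshP-inst _ (bang M) (WellScoped⇒Resolves pe l sc)

  canonical-resNames : ∀ Γ P x → x ∈ resNames (canonical Γ P) → x ∈X χ
  canonical-resNames Γ (ν y τ P) x (here refl) = base τ , refl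
  canonical-resNames Γ (ν y τ P) x (there m)   = canonical-resNames _ P x m
  canonical-resNames Γ (P ∥ Q)   x m with ∈-++⁻ (resNames (canonical Γ P)) m
  ... | inj₁ q = canonical-resNames Γ P x q
  ... | inj₂ q = canonical-resNames Γ Q x q

  canonical∈Deriv : ∀ {Γ ts} R → PathEnv Γ ts → CompatNodes 𝒯 ts (forest R) →
                    WellScoped Γ (fn R) → R ∈ der P₀ → canonical Γ R ∈Deriv[ P₀ ] χ
  canonical∈Deriv {Γ} R pe c sc R∈P₀ =
    R , R∈P₀ , lookupEnv Γ , WellScoped-lookupEnv pe sc ,
    InstP-env⇒subst [] Γ (canonical-α R pe c sc)

  canonical-activeSeq : ∀ {Γ ts} P → PathEnv Γ ts → CompatNodes 𝒯 ts (forest P) →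
                        WellScoped Γ (fn P) → der P ⊆ der P₀ →
                        ∀ S → S ∈ activeSeq (canonical Γ P) → S ∈Deriv[ P₀ ] χ
  canonical-activeSeq (ν x τ P) pe (c , _) sc ds =
    canonical-activeSeq P (bind x (base τ) pe) c (WellScoped-bind _ x (χ (base τ)) (fn P) sc) ds
  canonical-activeSeq {Γ} (P ∥ Q) pe c sc ds S m
    with CompatNodes-++⁻ 𝒯 _ (forest P) c | ∈-++⁻ (activeSeq (canonical Γ P)) m
  ... | p , _ | inj₁ m′ = canonical-activeSeq P pe p (sc ∘ ∈-++⁺ˡ) (ds ∘ ∈-++⁺ˡ) S m′
  ... | _ , q | inj₂ m′ =
    canonical-activeSeq Q pe q (sc ∘ ∈-++⁺ʳ (fn P)) (ds ∘ ∈-++⁺ʳ (der P)) S m′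
  canonical-activeSeq R@(sq (M ⊕ M'))          pe c sc ds _ (here refl) =
    canonical∈Deriv R pe c sc (ds (here refl))
  canonical-activeSeq R@(sq (pre (inp a b) P)) pe c sc ds _ (here refl) =
    canonical∈Deriv R pe c sc (ds (here refl))
  canonical-activeSeq R@(sq (pre (out a b) P)) pe c sc ds _ (here refl) =
    canonical∈Deriv R pe c sc (ds (here refl))
  canonical-activeSeq R@(sq (pre tau P))       pe c sc ds _ (here refl) =
    canonical∈Deriv R pe c sc (ds (here refl))
  canonical-activeSeq R@(bang M)               pe c sc ds _ (here refl) =
    canonical∈Deriv R pe c sc (ds (here refl))

lemma9 : (𝒯 : TypeForest) (χ : Fin (size 𝒯) → Name) →
         Injective _≡_ _≡_ χ →
         (P : Proc (size 𝒯)) →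
         (∀ t → χ t ∉ fn P) →
         Compatible 𝒯 (forest P) →
         Σ (Proc (size 𝒯)) λ Q →
           Compatible 𝒯 (forest Q)
           × AlphaRenaming P Q
           × (∀ x → x ∈ resNames Q → x ∈X χ)
           × (∀ S → S ∈ activeSeq Q → S ∈Deriv[ P ] χ)
lemma9 𝒯 χ χ-inj P χ∉P compat =
  canonical [] P ,
  canonical-compatible [] [] P compat ,
  canonical-α P [] compat inj₂ ,
  canonical-resNames [] P ,
  canonical-activeSeq P [] compat inj₂ id
  where open Canonical 𝒯 χ χ-inj P χ∉P
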